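{- Let $n\ge 1$ and let $k,l,m$ be integers with $\gcd(k,l,m,n)=1$. Let $T$ be the $n\times n$ cyclic shift matrix and put $A=3I_n-T^{ -k}-T^{k}$, $B=3I_n-T^{ -l}-T^{l}$, $C=3I_n-T^{ -m}-T^{m}$. Then $Jac(Y(n;k,l,m))$ is isomorphic to the torsion subgroup of $\operatorname{coker}(M)=\mathbb{Z}^{2n}/M\mathbb{Z}^{2n}$, where $M$ is the $2n\times 2n$ integer block matrix $$M=\begin{pmatrix} -A-B+3AB & -A\\ -B & C\end{pmatrix}.$$
   Context: $T=\mathrm{circ}(0,1,0,\ldots,0)$ is the $n\times n$ permutation matrix of the cyclic shift $(x_0,\ldots,x_{n-1})\mapsto(x_1,\ldots,x_{n-1},x_0)$, i.e. $T_{i,i+1}=1$ with indices mod $n$, all other entries $0$; $I_n$ is the identity matrix. The $Y$-graph $Y(n;k,l,m)$ is the (multi)graph with vertices $v_{x,y}$, $x\in\{0,1,2,3\}$, $y\in\mathbb{Z}_n$, and edges $v_{1,y}v_{1,y+k}$, $v_{2,y}v_{2,y+l}$, $v_{3,y}v_{3,y+m}$ and $v_{i,y}v_{0,y}$ for $i=1,2,3$, for all $y\in\mathbb{Z}_n$ (indices mod $n$). With the vertices ordered by $x=0,1,2,3$, its Laplacian matrix (degree matrix minus adjacency matrix) is $$L=\begin{pmatrix}3I_n&-I_n&-I_n&-I_n\\-I_n&A&0&0\\-I_n&0&B&0\\-I_n&0&0&C\end{pmatrix}.$$ For an integer $N\times N$ matrix $X$, $\operatorname{coker}(X)=\mathbb{Z}^N/X\mathbb{Z}^N$.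 The Jacobian group $Jac(Y(n;k,l,m))$ is defined as the torsion subgroup of $\operatorname{coker}(L)$. -}

module Defs where

open import Data.Nat as ℕ using (ℕ; zero; suc; _≡ᵇ_)
open import Data.Nat.GCD using (gcd)
open import Data.Integer as ℤ using (ℤ; +_; -[1+_]; _+_; _*_; _-_; -_; ∣_∣)
open import Data.Fin using (Fin; toℕ)
import Data.Fin as Fin
open import Data.Bool using (if_then_else_)
open import Data.Product using (Σ; ∃; _×_; _,_; proj₁)
open import Relation.Binary.PropositionalEquality using (_≡_)

infixl 7 _·ₘ_ _•ₘ_
infixl 6 _+ₘ_ _-ₘ_
infix 8 -ₘ_
infixr 9 _^ₘ_

Mat : ℕ → Set
Mat n = Fin n → Fin n → ℤ

∑ : ∀ {n} → (Fin n → ℤ) → ℤ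
∑ {zero}  f = + 0
∑ {suc n} f = f Fin.zero + ∑ (λ i → f (Fin.suc i))

_·ₘ_ : ∀ {n} → Mat n → Mat n → Mat n
(X ·ₘ Y) i j = ∑ (λ t → X i t * Y t j)

_+ₘ_ : ∀ {n} → Mat n → Mat n → Mat n
(X +ₘ Y) i j = X i j + Y i j

_-ₘ_ : ∀ {n} → Mat n → Mat n → Mat n
(X -ₘ Y) i j = X i j - Y i j

-ₘ_ : ∀ {n} → Mat n → Mat n
(-ₘ X) i j = - X i j

_•ₘ_ : ∀ {n} → ℤ → Mat n → Mat n
(c •ₘ X) i j = c * X i j

0ₘ : ∀ {n} → Mat n
0ₘ i j = + 0

Iₘ : ∀ {n} → Mat n
Iₘ i j = if toℕ i ≡ᵇ toℕ j then + 1 else + 0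

transpose : ∀ {n} → Mat n → Mat n
transpose X i j = X j i

_^ₘ_ : ∀ {n} → Mat n → ℕ → Mat n
X ^ₘ zero  = Iₘ
X ^ₘ suc k = X ·ₘ (X ^ₘ k)

nextMod : ℕ → ℕ → ℕ
nextMod n i = if suc i ≡ᵇ n then 0 else suc i

Tshift : ∀ n → Mat n
Tshift n i j = if toℕ j ≡ᵇ nextMod n (toℕ i) then + 1 else + 0

-- T is a permutation matrix, so T⁻¹ = Tᵀ
TshiftInv : ∀ n → Mat n
TshiftInv n = transpose (Tshift n)

Tpow : ∀ n → ℤ → Mat n
Tpow n (+ k)     = Tshift n ^ₘ k
Tpow n -[1+ k ]  = TshiftInv n ^ₘ suc k

cycBlock : ∀ n → ℤ → Mat n
cycBlock n k = ((+ 3 •ₘ Iₘ) -ₘ Tpow n (- k)) -ₘ Tpow n k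

-- r × r block matrices with n × n blocks, acting on ℤ^(r·n),
-- where ℤ^(r·n) is indexed by (block index, position in block)

BMat : ℕ → ℕ → Set
BMat r n = Fin r → Fin r → Mat n

BVec : ℕ → ℕ → Set
BVec r n = Fin r → Fin n → ℤ

_⊙_ : ∀ {r n} → BMat r n → BVec r n → BVec r n
(X ⊙ z) a i = ∑ (λ b → ∑ (λ j → X a b i j * z b j))

-- equality in coker(X) = ℤ^N / X ℤ^N
_≈[_]_ : ∀ {r n} → BVec r n → BMat r n → BVec r n → Set
x ≈[ X ] y = ∃ λ z → ∀ a i → x a i - y a i ≡ (X ⊙ z) a i

zeroV : ∀ {r n} → BVec r n
zeroV a i = + 0

_+ᵥ_ : ∀ {r n} → BVec r n → BVec r n → BVec r n
(x +ᵥ y) a i = x a i + y a i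

_•ᵥ_ : ∀ {r n} → ℤ → BVec r n → BVec r n
(c •ᵥ x) a i = c * x a i

IsTorsion : ∀ {r n} → BMat r n → BVec r n → Set
IsTorsion {r} {n} X x = ∃ λ (d : ℕ) → ((+ suc d) •ᵥ x) ≈[ X ] (zeroV {r} {n})

-- torsion subgroup of coker(X): torsion representatives, with equality ≈[ X ]
Tor : ∀ {r n} → BMat r n → Set
Tor {r} {n} X = Σ (BVec r n) (IsTorsion X)

-- group isomorphism Tor(coker X) ≅ Tor(coker Y), given on representatives:
-- well defined, additive, injective and surjective on classes
record TorIso {r s n : ℕ} (X : BMat r n) (Y : BMat s n) : Set where
  field
    f     : Tor X → Tor Y
    cong  : ∀ u v → proj₁ u ≈[ X ] proj₁ v → proj₁ (f u) ≈[ Y ] proj₁ (f v)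
    hom   : ∀ u v w → proj₁ w ≈[ X ] (proj₁ u +ᵥ proj₁ v) →
              proj₁ (f w) ≈[ Y ] (proj₁ (f u) +ᵥ proj₁ (f v))
    inj   : ∀ u v → proj₁ (f u) ≈[ Y ] proj₁ (f v) → proj₁ u ≈[ X ] proj₁ v
    surj  : ∀ (w : Tor Y) → ∃ λ (u : Tor X) → proj₁ (f u) ≈[ Y ] proj₁ w

-- The Laplacian of Y(n;k,l,m) (block form, vertex classes x = 0,1,2,3)

laplacianY : ∀ n → ℤ → ℤ → ℤ → BMat 4 n
laplacianY n k l m = L
  where
  A = cycBlock n k
  B = cycBlock n l
  C = cycBlock n m
  L : BMat 4 n
  L Fin.zero Fin.zero = + 3 •ₘ Iₘ
  L Fin.zero (Fin.suc _) = -ₘ Iₘ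
  L (Fin.suc _) Fin.zero = -ₘ Iₘ
  L (Fin.suc Fin.zero) (Fin.suc Fin.zero) = A
  L (Fin.suc (Fin.suc Fin.zero)) (Fin.suc (Fin.suc Fin.zero)) = B
  L (Fin.suc (Fin.suc (Fin.suc Fin.zero))) (Fin.suc (Fin.suc (Fin.suc Fin.zero))) = C
  L (Fin.suc _) (Fin.suc _) = 0ₘ

-- Jac(Y(n;k,l,m)) := torsion subgroup of coker(laplacianY n k l m)

matrixM : ∀ n → ℤ → ℤ → ℤ → BMat 2 n
matrixM n k l m = M
  where
  A = cycBlock n k
  B = cycBlock n l
  C = cycBlock n m
  M : BMat 2 n
  M Fin.zero Fin.zero = ((-ₘ A) -ₘ B) +ₘ (+ 3 •ₘ (A ·ₘ B))
  M Fin.zero (Fin.suc _) = -ₘ A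
  M (Fin.suc _) Fin.zero = -ₘ B
  M (Fin.suc _) (Fin.suc _) = C

gcd4 : ℤ → ℤ → ℤ → ℕ → ℕ
gcd4 k l m n = gcd (gcd (gcd ∣ k ∣ ∣ l ∣) ∣ m ∣) n

-- Write y = L z for the Laplacian L acting on ℤ^(4n), with z = (z₀, z₁, z₂, z₃)
-- split by vertex class. Rows 2 and 0 of y = L z can be solved for z₀ = B z₂ − y₂ and
-- z₁ = 3 z₀ − z₂ − z₃ − y₀; substituting these into rows 1 and 3 leaves exactly M acting on
-- (z₂, z₃). Hence y ↦ (y₁ + A y₀ + 3 A y₂ − y₂ , y₃ − y₂) maps the image of L onto the image
-- of M, and together with the inclusion u ↦ (0, u₀, 0, u₁) it induces mutually inverse
-- isomorphisms coker L ≅ coker M, which restrict to the torsion subgroups.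

module Submission where

open import Defs
open import Data.Nat using (ℕ; zero; suc; _≤_)
open import Data.Integer using (ℤ; +_; _+_; _*_; _-_; -_; -1ℤ)
open import Data.Integer.Properties
  using ( +-*-semiring; *-commutativeSemigroup; +-identityˡ; +-identityʳ; *-identityˡ; *-assoc
        ; *-zeroʳ; *-distribˡ-+; *-distribʳ-+; neg-distribˡ-*; neg-distribʳ-*; -1*i≡-i; i≡j⇒i-j≡0)
open import Algebra.Properties.CommutativeSemigroup *-commutativeSemigroup using (x∙yz≈y∙xz)
open import Algebra.Properties.Semiring.Sum +-*-semiring as Sum
  using (sum; sum-cong-≗; sum-replicate-zero; *-distribˡ-sum; *-distribʳ-sum)
open import Data.Integer.Tactic.RingSolver using (solve-∀)
open import Data.Fin using (Fin)
open import Data.Fin.Patterns using (0F; 1F; 2F; 3F)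
open import Data.Vec.Functional using (_∷_; [])
open import Data.Product using (∃; _,_)
open import Relation.Binary.PropositionalEquality

∑≡sum : ∀ {n} (f : Fin n → ℤ) → ∑ f ≡ sum {n} f
∑≡sum {zero}  f = refl
∑≡sum {suc n} f = cong (_+_ (f 0F)) (∑≡sum (λ i → f (Fin.suc i)))

∑-cong : ∀ {n} {f g : Fin n → ℤ} → f ≗ g → ∑ f ≡ ∑ g
∑-cong {n} {f} {g} f≗g = trans (∑≡sum f) (trans (sum-cong-≗ {n} f≗g) (sym (∑≡sum g)))

∑-zero : ∀ n → ∑ {n} (λ _ → + 0) ≡ + 0
∑-zero n = trans (∑≡sum {n} (λ _ → + 0)) (sum-replicate-zero n)

∑-distrib-+ : ∀ {n} (f g : Fin n → ℤ) → ∑ (λ i → f i + g i) ≡ ∑ f + ∑ g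
∑-distrib-+ f g = begin
  ∑ (λ i → f i + g i)   ≡⟨ ∑≡sum (λ i → f i + g i) ⟩
  sum (λ i → f i + g i) ≡⟨ Sum.∑-distrib-+ f g ⟩
  sum f + sum g         ≡⟨ sym (cong₂ _+_ (∑≡sum f) (∑≡sum g)) ⟩
  ∑ f + ∑ g             ∎
  where open ≡-Reasoning

*-distribˡ-∑ : ∀ {n} c (f : Fin n → ℤ) → c * ∑ f ≡ ∑ (λ i → c * f i)
*-distribˡ-∑ c f = begin
  c * ∑ f               ≡⟨ cong (c *_) (∑≡sum f) ⟩
  c * sum f             ≡⟨ *-distribˡ-sum c f ⟩
  sum (λ i → c * f i)   ≡⟨ sym (∑≡sum (λ i → c * f i)) ⟩
  ∑ (λ i → c * f i)     ∎
  where open ≡-Reasoning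

*-distribʳ-∑ : ∀ {n} c (f : Fin n → ℤ) → ∑ f * c ≡ ∑ (λ i → f i * c)
*-distribʳ-∑ c f = begin
  ∑ f * c               ≡⟨ cong (_* c) (∑≡sum f) ⟩
  sum f * c             ≡⟨ *-distribʳ-sum c f ⟩
  sum (λ i → f i * c)   ≡⟨ sym (∑≡sum (λ i → f i * c)) ⟩
  ∑ (λ i → f i * c)     ∎
  where open ≡-Reasoning

neg-distrib-∑ : ∀ {n} (f : Fin n → ℤ) → - ∑ f ≡ ∑ (λ i → - f i)
neg-distrib-∑ f = begin
  - ∑ f                 ≡⟨ sym (-1*i≡-i (∑ f)) ⟩
  -1ℤ * ∑ f             ≡⟨ *-distribˡ-∑ -1ℤ f ⟩
  ∑ (λ i → -1ℤ * f i)   ≡⟨ ∑-cong (λ i → -1*i≡-i (f i)) ⟩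
  ∑ (λ i → - f i)       ∎
  where open ≡-Reasoning

∑-linear : ∀ {n} c d (f g : Fin n → ℤ) → ∑ (λ i → c * f i + d * g i) ≡ c * ∑ f + d * ∑ g
∑-linear c d f g = begin
  ∑ (λ i → c * f i + d * g i)           ≡⟨ ∑-distrib-+ (λ i → c * f i) (λ i → d * g i) ⟩
  ∑ (λ i → c * f i) + ∑ (λ i → d * g i) ≡⟨ sym (cong₂ _+_ (*-distribˡ-∑ c f) (*-distribˡ-∑ d g)) ⟩
  c * ∑ f + d * ∑ g                     ∎
  where open ≡-Reasoning

∑-swap : ∀ {m n} (f : Fin m → Fin n → ℤ) → ∑ (λ i → ∑ (f i)) ≡ ∑ (λ j → ∑ (λ i → f i j))
∑-swap f = begin
  ∑ (λ i → ∑ (f i))               ≡⟨ ∑≡sum (λ i → ∑ (f i)) ⟩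
  sum (λ i → ∑ (f i))             ≡⟨ sum-cong-≗ (λ i → ∑≡sum (f i)) ⟩
  sum (λ i → sum (f i))           ≡⟨ Sum.∑-comm f ⟩
  sum (λ j → sum (λ i → f i j))   ≡⟨ sym (sum-cong-≗ (λ j → ∑≡sum (λ i → f i j))) ⟩
  sum (λ j → ∑ (λ i → f i j))     ≡⟨ sym (∑≡sum (λ j → ∑ (λ i → f i j))) ⟩
  ∑ (λ j → ∑ (λ i → f i j))       ∎
  where open ≡-Reasoning

infixr 8 _·ᵥ_

_·ᵥ_ : ∀ {n} → Mat n → (Fin n → ℤ) → Fin n → ℤ
(X ·ᵥ v) i = ∑ (λ j → X i j * v j)

-- Off-diagonal entries of Iₘ are + 0, and + 0 * x computes to + 0, so those terms vanish definitionally.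
·ᵥ-identityˡ : ∀ {n} (v : Fin n → ℤ) → Iₘ ·ᵥ v ≗ v
·ᵥ-identityˡ {suc n} v 0F = begin
  + 1 * v 0F + ∑ {n} (λ _ → + 0)   ≡⟨ cong₂ _+_ (*-identityˡ (v 0F)) (∑-zero n) ⟩
  v 0F + + 0                        ≡⟨ +-identityʳ (v 0F) ⟩
  v 0F                              ∎
  where open ≡-Reasoning
·ᵥ-identityˡ {suc n} v (Fin.suc i) = trans (+-identityˡ _) (·ᵥ-identityˡ (λ j → v (Fin.suc j)) i)

module _ {n : ℕ} where

  ·ᵥ-congʳ : ∀ (X : Mat n) {v w} → v ≗ w → X ·ᵥ v ≗ X ·ᵥ w
  ·ᵥ-congʳ X v≗w i = ∑-cong (λ j → cong (X i j *_) (v≗w j))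

  ·ᵥ-+ʳ : ∀ (X : Mat n) v w i → (X ·ᵥ (λ j → v j + w j)) i ≡ (X ·ᵥ v) i + (X ·ᵥ w) i
  ·ᵥ-+ʳ X v w i = trans (∑-cong (λ j → *-distribˡ-+ (X i j) (v j) (w j)))
                        (∑-distrib-+ (λ j → X i j * v j) (λ j → X i j * w j))

  ·ᵥ-*ʳ : ∀ (X : Mat n) c v i → (X ·ᵥ (λ j → c * v j)) i ≡ c * (X ·ᵥ v) i
  ·ᵥ-*ʳ X c v i =
    trans (∑-cong (λ j → x∙yz≈y∙xz (X i j) c (v j))) (sym (*-distribˡ-∑ c (λ j → X i j * v j)))

  ·ᵥ-negʳ : ∀ (X : Mat n) v i → (X ·ᵥ (λ j → - v j)) i ≡ - (X ·ᵥ v) i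
  ·ᵥ-negʳ X v i = trans (∑-cong (λ j → sym (neg-distribʳ-* (X i j) (v j))))
                        (sym (neg-distrib-∑ (λ j → X i j * v j)))

  ·ᵥ--ʳ : ∀ (X : Mat n) v w i → (X ·ᵥ (λ j → v j - w j)) i ≡ (X ·ᵥ v) i - (X ·ᵥ w) i
  ·ᵥ--ʳ X v w i = trans (·ᵥ-+ʳ X v (λ j → - w j) i) (cong (_+_ ((X ·ᵥ v) i)) (·ᵥ-negʳ X w i))

  ·ᵥ-zeroʳ : ∀ (X : Mat n) i → (X ·ᵥ (λ _ → + 0)) i ≡ + 0
  ·ᵥ-zeroʳ X i = trans (∑-cong (λ j → *-zeroʳ (X i j))) (∑-zero n)

  ·ᵥ-linear : ∀ (X : Mat n) c d v w i →
              (X ·ᵥ (λ j → c * v j + d * w j)) i ≡ c * (X ·ᵥ v) i + d * (X ·ᵥ w) i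
  ·ᵥ-linear X c d v w i =
    trans (·ᵥ-+ʳ X (λ j → c * v j) (λ j → d * w j) i) (cong₂ _+_ (·ᵥ-*ʳ X c v i) (·ᵥ-*ʳ X d w i))

  ·ᵥ-zeroˡ : ∀ (v : Fin n → ℤ) i → (0ₘ ·ᵥ v) i ≡ + 0
  ·ᵥ-zeroˡ v i = ∑-zero n

  ·ᵥ-distribʳ-+ₘ : ∀ (X Y : Mat n) v i → ((X +ₘ Y) ·ᵥ v) i ≡ (X ·ᵥ v) i + (Y ·ᵥ v) i
  ·ᵥ-distribʳ-+ₘ X Y v i = trans (∑-cong (λ j → *-distribʳ-+ (v j) (X i j) (Y i j)))
                                 (∑-distrib-+ (λ j → X i j * v j) (λ j → Y i j * v j))

  ·ᵥ-negˡ : ∀ (X : Mat n) v i → ((-ₘ X) ·ᵥ v) i ≡ - (X ·ᵥ v) i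
  ·ᵥ-negˡ X v i = trans (∑-cong (λ j → sym (neg-distribˡ-* (X i j) (v j))))
                        (sym (neg-distrib-∑ (λ j → X i j * v j)))

  ·ᵥ-distribʳ--ₘ : ∀ (X Y : Mat n) v i → ((X -ₘ Y) ·ᵥ v) i ≡ (X ·ᵥ v) i - (Y ·ᵥ v) i
  ·ᵥ-distribʳ--ₘ X Y v i =
    trans (·ᵥ-distribʳ-+ₘ X (-ₘ Y) v i) (cong (_+_ ((X ·ᵥ v) i)) (·ᵥ-negˡ Y v i))

  ·ᵥ-•ₘ : ∀ c (X : Mat n) v i → ((c •ₘ X) ·ᵥ v) i ≡ c * (X ·ᵥ v) i
  ·ᵥ-•ₘ c X v i =
    trans (∑-cong (λ j → *-assoc c (X i j) (v j))) (sym (*-distribˡ-∑ c (λ j → X i j * v j)))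

  ·ᵥ-assoc : ∀ (X Y : Mat n) v i → ((X ·ₘ Y) ·ᵥ v) i ≡ (X ·ᵥ (Y ·ᵥ v)) i
  ·ᵥ-assoc X Y v i = begin
    ∑ (λ j → ∑ (λ t → X i t * Y t j) * v j)
      ≡⟨ ∑-cong (λ j → *-distribʳ-∑ (v j) (λ t → X i t * Y t j)) ⟩
    ∑ (λ j → ∑ (λ t → X i t * Y t j * v j))
      ≡⟨ ∑-swap (λ j t → X i t * Y t j * v j) ⟩
    ∑ (λ t → ∑ (λ j → X i t * Y t j * v j))
      ≡⟨ ∑-cong (λ t → ∑-cong (λ j → *-assoc (X i t) (Y t j) (v j))) ⟩
    ∑ (λ t → ∑ (λ j → X i t * (Y t j * v j)))
      ≡⟨ ∑-cong (λ t → sym (*-distribˡ-∑ (X i t) (λ j → Y t j * v j))) ⟩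
    ∑ (λ t → X i t * (Y ·ᵥ v) t)
      ∎
    where open ≡-Reasoning

-- Images and cokernels

infix 4 _≋_ _∈Im_

_≋_ : ∀ {r n} → BVec r n → BVec r n → Set
u ≋ v = ∀ a i → u a i ≡ v a i

≋-sym : ∀ {r n} {u v : BVec r n} → u ≋ v → v ≋ u
≋-sym u≋v a i = sym (u≋v a i)

≋-trans : ∀ {r n} {u v w : BVec r n} → u ≋ v → v ≋ w → u ≋ w
≋-trans u≋v v≋w a i = trans (u≋v a i) (v≋w a i)

_-ᵥ_ : ∀ {r n} → BVec r n → BVec r n → BVec r n
(x -ᵥ y) a i = x a i - y a i

-- x ≈[ X ] y unfolds to (x -ᵥ y) ∈Im X.
_∈Im_ : ∀ {r n} → BVec r n → BMat r n → Set
v ∈Im X = ∃ λ z → v ≋ X ⊙ z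

record LinearMap (r s n : ℕ) : Set where
  field
    apply        : BVec r n → BVec s n
    apply-cong   : ∀ {x y} → x ≋ y → apply x ≋ apply y
    apply-linear : ∀ c d x y → apply ((c •ᵥ x) +ᵥ (d •ᵥ y)) ≋ (c •ᵥ apply x) +ᵥ (d •ᵥ apply y)

  private
    via : ∀ c d x y {u v} → u ≋ (c •ᵥ x) +ᵥ (d •ᵥ y) → (c •ᵥ apply x) +ᵥ (d •ᵥ apply y) ≋ v →
          apply u ≋ v
    via c d x y u≋ ≋v a i = trans (apply-cong u≋ a i) (trans (apply-linear c d x y a i) (≋v a i))

    split-+ : ∀ p q → p + q ≡ + 1 * p + + 1 * q
    split-+ = solve-∀

    split-- : ∀ p q → p - q ≡ + 1 * p + -1ℤ * q
    split-- = solve-∀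

    split-• : ∀ c p → c * p ≡ c * p + + 0 * p
    split-• = solve-∀

  apply-+ : ∀ x y → apply (x +ᵥ y) ≋ apply x +ᵥ apply y
  apply-+ x y = via (+ 1) (+ 1) x y (λ a i → split-+ (x a i) (y a i))
                                    (λ a i → sym (split-+ (apply x a i) (apply y a i)))

  apply-- : ∀ x y → apply (x -ᵥ y) ≋ apply x -ᵥ apply y
  apply-- x y = via (+ 1) -1ℤ x y (λ a i → split-- (x a i) (y a i))
                                  (λ a i → sym (split-- (apply x a i) (apply y a i)))

  apply-• : ∀ c x → apply (c •ᵥ x) ≋ c •ᵥ apply x
  apply-• c x = via c (+ 0) x x (λ a i → split-• c (x a i))
                                (λ a i → sym (split-• c (apply x a i)))

  apply-zero : apply zeroV ≋ zeroV
  apply-zero = via (+ 0) (+ 0) zeroV zeroV (λ a i → refl) (λ a i → refl)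

open LinearMap public using (apply)

⊙-linearMap : ∀ {r n} → BMat r n → LinearMap r r n
⊙-linearMap X = record
  { apply        = X ⊙_
  ; apply-cong   = λ x≋y a i → ∑-cong (λ b → ·ᵥ-congʳ (X a b) (x≋y b) i)
  ; apply-linear = λ c d x y a i →
      trans (∑-cong (λ b → ·ᵥ-linear (X a b) c d (x b) (y b) i))
            (∑-linear c d (λ b → (X a b ·ᵥ x b) i) (λ b → (X a b ·ᵥ y b) i))
  }

module _ {r n : ℕ} (X : BMat r n) where

  ∈Im-resp : ∀ {u v} → u ≋ v → u ∈Im X → v ∈Im X
  ∈Im-resp u≋v (z , u≋Xz) = z , λ a i → trans (sym (u≋v a i)) (u≋Xz a i)

  ∈Im-linear : ∀ c d {u v} → u ∈Im X → v ∈Im X → (c •ᵥ u) +ᵥ (d •ᵥ v) ∈Im X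
  ∈Im-linear c d (z , u≋Xz) (z′ , v≋Xz′) = (c •ᵥ z) +ᵥ (d •ᵥ z′) , λ a i →
    trans (cong₂ (λ p q → c * p + d * q) (u≋Xz a i) (v≋Xz′ a i))
          (sym (LinearMap.apply-linear (⊙-linearMap X) c d z z′ a i))

  ≈-reflexive : ∀ {x y} → x ≋ y → x ≈[ X ] y
  ≈-reflexive x≋y = zeroV , λ a i →
    trans (i≡j⇒i-j≡0 (x≋y a i)) (sym (LinearMap.apply-zero (⊙-linearMap X) a i))

  ≈-sym : ∀ {x y} → x ≈[ X ] y → y ≈[ X ] x
  ≈-sym {x} {y} p = ∈Im-resp (λ a i → flip (x a i) (y a i)) (∈Im-linear -1ℤ (+ 0) p p)
    where
    flip : ∀ p q → -1ℤ * (p - q) + + 0 * (p - q) ≡ q - p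
    flip = solve-∀

  ≈-trans : ∀ {x y z} → x ≈[ X ] y → y ≈[ X ] z → x ≈[ X ] z
  ≈-trans {x} {y} {z} p q =
    ∈Im-resp (λ a i → telescope (x a i) (y a i) (z a i)) (∈Im-linear (+ 1) (+ 1) p q)
    where
    telescope : ∀ p q s → + 1 * (p - q) + + 1 * (q - s) ≡ p - s
    telescope = solve-∀

module Induced {r s n : ℕ} (X : BMat r n) (Y : BMat s n) (F : LinearMap r s n)
               (F-image : ∀ {x} → x ∈Im X → apply F x ∈Im Y) where

  open LinearMap F using (apply-+; apply--; apply-•; apply-zero)

  map-≈ : ∀ {x y} → x ≈[ X ] y → apply F x ≈[ Y ] apply F y
  map-≈ {x} {y} p = ∈Im-resp Y (apply-- x y) (F-image p)

  map-torsion : ∀ {x} → IsTorsion X x → IsTorsion Y (apply F x)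
  map-torsion {x} (d , p) =
    d , ∈Im-resp Y (λ a i → cong₂ _-_ (apply-• (+ suc d) x a i) (apply-zero a i)) (map-≈ p)

  map-+ : ∀ {u v w} → w ≈[ X ] (u +ᵥ v) → apply F w ≈[ Y ] (apply F u +ᵥ apply F v)
  map-+ {u} {v} {w} p = ∈Im-resp Y (λ a i → cong (_-_ (apply F w a i)) (apply-+ u v a i)) (map-≈ p)

record CokernelEquivalence {r s n : ℕ} (X : BMat r n) (Y : BMat s n) : Set where
  field
    F       : LinearMap r s n
    G       : LinearMap s r n
    F-image : ∀ {x} → x ∈Im X → apply F x ∈Im Y
    G-image : ∀ {u} → u ∈Im Y → apply G u ∈Im X
    F∘G≈id  : ∀ u → apply F (apply G u) ≈[ Y ] u
    G∘F≈id  : ∀ x → apply G (apply F x) ≈[ X ] x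

  private
    module F* = Induced X Y F F-image
    module G* = Induced Y X G G-image

    G∘F : BVec r n → BVec r n
    G∘F x = apply G (apply F x)

  torIso : TorIso X Y
  torIso = record
    { f    = λ { (x , t) → apply F x , F*.map-torsion t }
    ; cong = λ _ _ → F*.map-≈
    ; hom  = λ _ _ _ → F*.map-+
    ; inj  = λ { (x , _) (y , _) p →
               ≈-trans X {x} {G∘F x} (≈-sym X {G∘F x} (G∘F≈id x))
                 (≈-trans X {G∘F x} {G∘F y} (G*.map-≈ p) (G∘F≈id y)) }
    ; surj = λ { (u , t) → (apply G u , G*.map-torsion t) , F∘G≈id u }
    }

-- Reduction of the Laplacian of a Y-graph

module YGraphReduction {n : ℕ} (A B C : Mat n) where

  laplacianAction : BVec 4 n → BVec 4 n
  laplacianAction z 0F i = + 3 * z 0F i - z 1F i - z 2F i - z 3F i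
  laplacianAction z 1F i = (A ·ᵥ z 1F) i - z 0F i
  laplacianAction z 2F i = (B ·ᵥ z 2F) i - z 0F i
  laplacianAction z 3F i = (C ·ᵥ z 3F) i - z 0F i

  reducedAction : BVec 2 n → BVec 2 n
  reducedAction w 0F i = + 3 * (A ·ᵥ (B ·ᵥ w 0F)) i - (A ·ᵥ w 0F) i - (B ·ᵥ w 0F) i - (A ·ᵥ w 1F) i
  reducedAction w 1F i = (C ·ᵥ w 1F) i - (B ·ᵥ w 0F) i

  eliminate : BVec 4 n → BVec 2 n
  eliminate y 0F i = y 1F i + (A ·ᵥ y 0F) i + + 3 * (A ·ᵥ y 2F) i - y 2F i
  eliminate y 1F i = y 3F i - y 2F i

  include : BVec 2 n → BVec 4 n
  include u = (λ _ → + 0) ∷ u 0F ∷ (λ _ → + 0) ∷ u 1F ∷ []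

  eliminate-laplacian : ∀ z → eliminate (laplacianAction z) ≋ reducedAction (z 2F ∷ z 3F ∷ [])
  eliminate-laplacian z 0F i = begin
    (Az1 - z0) + (A ·ᵥ laplacianAction z 0F) i + + 3 * (A ·ᵥ laplacianAction z 2F) i - (Bz2 - z0)
      ≡⟨ cong₂ (λ p q → (Az1 - z0) + p + + 3 * q - (Bz2 - z0)) A-row₀ A-row₂ ⟩
    (Az1 - z0) + (+ 3 * Az0 - Az1 - Az2 - Az3) + + 3 * (ABz2 - Az0) - (Bz2 - z0)
      ≡⟨ collect z0 Az0 Az1 Az2 Az3 Bz2 ABz2 ⟩
    + 3 * ABz2 - Az2 - Bz2 - Az3
      ∎
    where
    open ≡-Reasoning
    z0 Az0 Az1 Az2 Az3 Bz2 ABz2 : ℤ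
    z0 = z 0F i; Az0 = (A ·ᵥ z 0F) i; Az1 = (A ·ᵥ z 1F) i; Az2 = (A ·ᵥ z 2F) i
    Az3 = (A ·ᵥ z 3F) i; Bz2 = (B ·ᵥ z 2F) i; ABz2 = (A ·ᵥ (B ·ᵥ z 2F)) i
    A-row₀ : (A ·ᵥ laplacianAction z 0F) i ≡ + 3 * Az0 - Az1 - Az2 - Az3
    A-row₀ = begin
      (A ·ᵥ laplacianAction z 0F) i
        ≡⟨ ·ᵥ--ʳ A (λ j → + 3 * z 0F j - z 1F j - z 2F j) (z 3F) i ⟩
      (A ·ᵥ (λ j → + 3 * z 0F j - z 1F j - z 2F j)) i - Az3
        ≡⟨ cong (_- Az3) (·ᵥ--ʳ A (λ j → + 3 * z 0F j - z 1F j) (z 2F) i) ⟩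
      (A ·ᵥ (λ j → + 3 * z 0F j - z 1F j)) i - Az2 - Az3
        ≡⟨ cong (λ p → p - Az2 - Az3) (·ᵥ--ʳ A (λ j → + 3 * z 0F j) (z 1F) i) ⟩
      (A ·ᵥ (λ j → + 3 * z 0F j)) i - Az1 - Az2 - Az3
        ≡⟨ cong (λ p → p - Az1 - Az2 - Az3) (·ᵥ-*ʳ A (+ 3) (z 0F) i) ⟩
      + 3 * Az0 - Az1 - Az2 - Az3
        ∎
    A-row₂ : (A ·ᵥ laplacianAction z 2F) i ≡ ABz2 - Az0
    A-row₂ = ·ᵥ--ʳ A (B ·ᵥ z 2F) (z 0F) i
    collect : ∀ z0 Az0 Az1 Az2 Az3 Bz2 ABz2 →
      (Az1 - z0) + (+ 3 * Az0 - Az1 - Az2 - Az3) + + 3 * (ABz2 - Az0) - (Bz2 - z0)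
        ≡ + 3 * ABz2 - Az2 - Bz2 - Az3
    collect = solve-∀
  eliminate-laplacian z 1F i = cancel ((C ·ᵥ z 3F) i) ((B ·ᵥ z 2F) i) (z 0F i)
    where
    cancel : ∀ p q r → (p - r) - (q - r) ≡ p - q
    cancel = solve-∀

  preimage : BVec 2 n → BVec 4 n
  preimage w = B ·ᵥ w 0F ∷ (λ j → + 3 * (B ·ᵥ w 0F) j - w 0F j - w 1F j) ∷ w 0F ∷ w 1F ∷ []

  include-reduced : ∀ w → include (reducedAction w) ≋ laplacianAction (preimage w)
  include-reduced w 0F i = balance ((B ·ᵥ w 0F) i) (w 0F i) (w 1F i)
    where
    balance : ∀ p q r → + 0 ≡ + 3 * p - (+ 3 * p - q - r) - q - r
    balance = solve-∀
  include-reduced w 1F i = begin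
    + 3 * ABw0 - Aw0 - Bw0 - Aw1
      ≡⟨ regroup ABw0 Aw0 Aw1 Bw0 ⟩
    (+ 3 * ABw0 - Aw0 - Aw1) - Bw0
      ≡⟨ cong (_- Bw0) (sym A-row₁) ⟩
    (A ·ᵥ preimage w 1F) i - Bw0
      ∎
    where
    open ≡-Reasoning
    Aw0 Aw1 Bw0 ABw0 : ℤ
    Aw0 = (A ·ᵥ w 0F) i; Aw1 = (A ·ᵥ w 1F) i; Bw0 = (B ·ᵥ w 0F) i; ABw0 = (A ·ᵥ (B ·ᵥ w 0F)) i
    A-row₁ : (A ·ᵥ preimage w 1F) i ≡ + 3 * ABw0 - Aw0 - Aw1
    A-row₁ = begin
      (A ·ᵥ preimage w 1F) i
        ≡⟨ ·ᵥ--ʳ A (λ j → + 3 * (B ·ᵥ w 0F) j - w 0F j) (w 1F) i ⟩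
      (A ·ᵥ (λ j → + 3 * (B ·ᵥ w 0F) j - w 0F j)) i - Aw1
        ≡⟨ cong (_- Aw1) (·ᵥ--ʳ A (λ j → + 3 * (B ·ᵥ w 0F) j) (w 0F) i) ⟩
      (A ·ᵥ (λ j → + 3 * (B ·ᵥ w 0F) j)) i - Aw0 - Aw1
        ≡⟨ cong (λ p → p - Aw0 - Aw1) (·ᵥ-*ʳ A (+ 3) (B ·ᵥ w 0F) i) ⟩
      + 3 * ABw0 - Aw0 - Aw1
        ∎
    regroup : ∀ p q r s → + 3 * p - q - s - r ≡ (+ 3 * p - q - r) - s
    regroup = solve-∀
  include-reduced w 2F i = sym (i≡j⇒i-j≡0 {(B ·ᵥ w 0F) i} refl)
  include-reduced w 3F i = refl

  eliminate-include : ∀ u → eliminate (include u) ≋ u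
  eliminate-include u 0F i = begin
    u 0F i + (A ·ᵥ (λ _ → + 0)) i + + 3 * (A ·ᵥ (λ _ → + 0)) i - + 0
      ≡⟨ cong₂ (λ p q → u 0F i + p + + 3 * q - + 0) (·ᵥ-zeroʳ A i) (·ᵥ-zeroʳ A i) ⟩
    u 0F i + + 0 + + 3 * + 0 - + 0
      ≡⟨ drop-zeros (u 0F i) ⟩
    u 0F i
      ∎
    where
    open ≡-Reasoning
    drop-zeros : ∀ p → p + + 0 + + 3 * + 0 - + 0 ≡ p
    drop-zeros = solve-∀
  eliminate-include u 1F i = +-identityʳ (u 1F i)

  correction : BVec 4 n → BVec 4 n
  correction x = x 2F ∷ (λ j → x 0F j + + 3 * x 2F j) ∷ (λ _ → + 0) ∷ (λ _ → + 0) ∷ []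

  include-eliminate : ∀ x → include (eliminate x) -ᵥ x ≋ laplacianAction (correction x)
  include-eliminate x 0F i = balance (x 0F i) (x 2F i)
    where
    balance : ∀ p q → + 0 - p ≡ + 3 * q - (p + + 3 * q) - + 0 - + 0
    balance = solve-∀
  include-eliminate x 1F i = begin
    (x 1F i + Ax0 + + 3 * Ax2 - x 2F i) - x 1F i ≡⟨ cancel (x 1F i) Ax0 Ax2 (x 2F i) ⟩
    (Ax0 + + 3 * Ax2) - x 2F i                   ≡⟨ cong (_- x 2F i) (sym A-row₁) ⟩
    (A ·ᵥ correction x 1F) i - x 2F i            ∎
    where
    open ≡-Reasoning
    Ax0 Ax2 : ℤ
    Ax0 = (A ·ᵥ x 0F) i; Ax2 = (A ·ᵥ x 2F) i
    A-row₁ : (A ·ᵥ correction x 1F) i ≡ Ax0 + + 3 * Ax2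
    A-row₁ = trans (·ᵥ-+ʳ A (x 0F) (λ j → + 3 * x 2F j) i) (cong (_+_ Ax0) (·ᵥ-*ʳ A (+ 3) (x 2F) i))
    cancel : ∀ p q r s → (p + q + + 3 * r - s) - p ≡ (q + + 3 * r) - s
    cancel = solve-∀
  include-eliminate x 2F i = cong (_- x 2F i) (sym (·ᵥ-zeroʳ B i))
  include-eliminate x 3F i = trans (cancel (x 3F i) (x 2F i)) (cong (_- x 2F i) (sym (·ᵥ-zeroʳ C i)))
    where
    cancel : ∀ p q → (p - q) - p ≡ + 0 - q
    cancel = solve-∀

  eliminateMap : LinearMap 4 2 n
  eliminateMap = record
    { apply        = eliminate
    ; apply-cong   = λ where
        x≋y 0F i → cong₂ _-_ (cong₂ _+_ (cong₂ _+_ (x≋y 1F i) (·ᵥ-congʳ A (x≋y 0F) i))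
                                         (cong (+ 3 *_) (·ᵥ-congʳ A (x≋y 2F) i)))
                             (x≋y 2F i)
        x≋y 1F i → cong₂ _-_ (x≋y 3F i) (x≋y 2F i)
    ; apply-linear = linear
    }
    where
    linear : ∀ c d x y → eliminate ((c •ᵥ x) +ᵥ (d •ᵥ y)) ≋ (c •ᵥ eliminate x) +ᵥ (d •ᵥ eliminate y)
    linear c d x y 0F i = begin
      (c * x 1F i + d * y 1F i) + (A ·ᵥ (λ j → c * x 0F j + d * y 0F j)) i
        + + 3 * (A ·ᵥ (λ j → c * x 2F j + d * y 2F j)) i - (c * x 2F i + d * y 2F i)
          ≡⟨ cong₂ (λ p q → (c * x 1F i + d * y 1F i) + p + + 3 * q - (c * x 2F i + d * y 2F i))
                   (·ᵥ-linear A c d (x 0F) (y 0F) i) (·ᵥ-linear A c d (x 2F) (y 2F) i) ⟩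
      (c * x 1F i + d * y 1F i) + (c * (A ·ᵥ x 0F) i + d * (A ·ᵥ y 0F) i)
        + + 3 * (c * (A ·ᵥ x 2F) i + d * (A ·ᵥ y 2F) i) - (c * x 2F i + d * y 2F i)
          ≡⟨ distribute c d (x 1F i) (y 1F i) ((A ·ᵥ x 0F) i) ((A ·ᵥ y 0F) i)
                            ((A ·ᵥ x 2F) i) ((A ·ᵥ y 2F) i) (x 2F i) (y 2F i) ⟩
      c * eliminate x 0F i + d * eliminate y 0F i
          ∎
      where
      open ≡-Reasoning
      distribute : ∀ c d p p′ q q′ r r′ s s′ →
        (c * p + d * p′) + (c * q + d * q′) + + 3 * (c * r + d * r′) - (c * s + d * s′)
          ≡ c * (p + q + + 3 * r - s) + d * (p′ + q′ + + 3 * r′ - s′)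
      distribute = solve-∀
    linear c d x y 1F i = distribute c d (x 3F i) (y 3F i) (x 2F i) (y 2F i)
      where
      distribute : ∀ c d p p′ q q′ → (c * p + d * p′) - (c * q + d * q′) ≡ c * (p - q) + d * (p′ - q′)
      distribute = solve-∀

  includeMap : LinearMap 2 4 n
  includeMap = record
    { apply        = include
    ; apply-cong   = λ where
        u≋v 0F i → refl
        u≋v 1F i → u≋v 0F i
        u≋v 2F i → refl
        u≋v 3F i → u≋v 1F i
    ; apply-linear = λ where
        c d u v 0F i → zero-combination c d
        c d u v 1F i → refl
        c d u v 2F i → zero-combination c d
        c d u v 3F i → refl
    }
    where
    zero-combination : ∀ c d → + 0 ≡ c * + 0 + d * + 0
    zero-combination = solve-∀

  module _ (L : BMat 4 n) (M : BMat 2 n)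
           (L-action : ∀ z → L ⊙ z ≋ laplacianAction z)
           (M-action : ∀ w → M ⊙ w ≋ reducedAction w) where

    cokernelEquivalence : CokernelEquivalence L M
    cokernelEquivalence = record
      { F       = eliminateMap
      ; G       = includeMap
      ; F-image = λ { (z , x≋Lz) → (z 2F ∷ z 3F ∷ []) ,
          ≋-trans (LinearMap.apply-cong eliminateMap (≋-trans x≋Lz (L-action z)))
            (≋-trans (eliminate-laplacian z) (≋-sym (M-action (z 2F ∷ z 3F ∷ [])))) }
      ; G-image = λ { (w , u≋Mw) → preimage w ,
          ≋-trans (LinearMap.apply-cong includeMap (≋-trans u≋Mw (M-action w)))
            (≋-trans (include-reduced w) (≋-sym (L-action (preimage w)))) }
      ; F∘G≈id  = λ u → ≈-reflexive M (eliminate-include u)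
      ; G∘F≈id  = λ x → correction x , ≋-trans (include-eliminate x) (≋-sym (L-action (correction x)))
      }

module _ (n : ℕ) (k l m : ℤ) where
  private
    A B C : Mat n
    A = cycBlock n k
    B = cycBlock n l
    C = cycBlock n m

    ·ᵥ-negIₘ : ∀ (v : Fin n → ℤ) i → ((-ₘ Iₘ) ·ᵥ v) i ≡ - v i
    ·ᵥ-negIₘ v i = trans (·ᵥ-negˡ Iₘ v i) (cong -_ (·ᵥ-identityˡ v i))

  open YGraphReduction A B C

  laplacianY-action : ∀ z → laplacianY n k l m ⊙ z ≋ laplacianAction z
  laplacianY-action z 0F i = begin
    ((+ 3 •ₘ Iₘ) ·ᵥ z 0F) i + (((-ₘ Iₘ) ·ᵥ z 1F) i + (((-ₘ Iₘ) ·ᵥ z 2F) i + (((-ₘ Iₘ) ·ᵥ z 3F) i + + 0)))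
      ≡⟨ cong₂ _+_ (trans (·ᵥ-•ₘ (+ 3) Iₘ (z 0F) i) (cong (+ 3 *_) (·ᵥ-identityˡ (z 0F) i)))
                   (cong₂ _+_ (·ᵥ-negIₘ (z 1F) i)
                              (cong₂ (λ p q → p + (q + + 0)) (·ᵥ-negIₘ (z 2F) i) (·ᵥ-negIₘ (z 3F) i))) ⟩
    + 3 * z 0F i + (- z 1F i + (- z 2F i + (- z 3F i + + 0)))
      ≡⟨ tidy (z 0F i) (z 1F i) (z 2F i) (z 3F i) ⟩
    + 3 * z 0F i - z 1F i - z 2F i - z 3F i
      ∎
    where
    open ≡-Reasoning
    tidy : ∀ p q r s → + 3 * p + (- q + (- r + (- s + + 0))) ≡ + 3 * p - q - r - s
    tidy = solve-∀
  laplacianY-action z 1F i = begin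
    ((-ₘ Iₘ) ·ᵥ z 0F) i + ((A ·ᵥ z 1F) i + ((0ₘ ·ᵥ z 2F) i + ((0ₘ ·ᵥ z 3F) i + + 0)))
      ≡⟨ cong₂ (λ p q → p + ((A ·ᵥ z 1F) i + q))
               (·ᵥ-negIₘ (z 0F) i) (cong₂ (λ p q → p + (q + + 0)) (·ᵥ-zeroˡ (z 2F) i) (·ᵥ-zeroˡ (z 3F) i)) ⟩
    - z 0F i + ((A ·ᵥ z 1F) i + + 0)
      ≡⟨ tidy (z 0F i) ((A ·ᵥ z 1F) i) ⟩
    (A ·ᵥ z 1F) i - z 0F i
      ∎
    where
    open ≡-Reasoning
    tidy : ∀ p q → - p + (q + + 0) ≡ q - p
    tidy = solve-∀
  laplacianY-action z 2F i = begin
    ((-ₘ Iₘ) ·ᵥ z 0F) i + ((0ₘ ·ᵥ z 1F) i + ((B ·ᵥ z 2F) i + ((0ₘ ·ᵥ z 3F) i + + 0)))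
      ≡⟨ cong₂ _+_ (·ᵥ-negIₘ (z 0F) i)
               (cong₂ (λ p q → p + ((B ·ᵥ z 2F) i + (q + + 0))) (·ᵥ-zeroˡ (z 1F) i) (·ᵥ-zeroˡ (z 3F) i)) ⟩
    - z 0F i + (+ 0 + ((B ·ᵥ z 2F) i + + 0))
      ≡⟨ tidy (z 0F i) ((B ·ᵥ z 2F) i) ⟩
    (B ·ᵥ z 2F) i - z 0F i
      ∎
    where
    open ≡-Reasoning
    tidy : ∀ p q → - p + (+ 0 + (q + + 0)) ≡ q - p
    tidy = solve-∀
  laplacianY-action z 3F i = begin
    ((-ₘ Iₘ) ·ᵥ z 0F) i + ((0ₘ ·ᵥ z 1F) i + ((0ₘ ·ᵥ z 2F) i + ((C ·ᵥ z 3F) i + + 0)))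
      ≡⟨ cong₂ _+_ (·ᵥ-negIₘ (z 0F) i)
               (cong₂ (λ p q → p + (q + ((C ·ᵥ z 3F) i + + 0))) (·ᵥ-zeroˡ (z 1F) i) (·ᵥ-zeroˡ (z 2F) i)) ⟩
    - z 0F i + (+ 0 + (+ 0 + ((C ·ᵥ z 3F) i + + 0)))
      ≡⟨ tidy (z 0F i) ((C ·ᵥ z 3F) i) ⟩
    (C ·ᵥ z 3F) i - z 0F i
      ∎
    where
    open ≡-Reasoning
    tidy : ∀ p q → - p + (+ 0 + (+ 0 + (q + + 0))) ≡ q - p
    tidy = solve-∀

  matrixM-action : ∀ w → matrixM n k l m ⊙ w ≋ reducedAction w
  matrixM-action w 0F i = begin
    ((((-ₘ A) -ₘ B) +ₘ (+ 3 •ₘ (A ·ₘ B))) ·ᵥ w 0F) i + (((-ₘ A) ·ᵥ w 1F) i + + 0)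
      ≡⟨ cong₂ (λ p q → p + (q + + 0)) expand (·ᵥ-negˡ A (w 1F) i) ⟩
    (- Aw0 - Bw0 + + 3 * ABw0) + (- Aw1 + + 0)
      ≡⟨ tidy Aw0 Bw0 ABw0 Aw1 ⟩
    + 3 * ABw0 - Aw0 - Bw0 - Aw1
      ∎
    where
    open ≡-Reasoning
    Aw0 Bw0 Aw1 ABw0 : ℤ
    Aw0 = (A ·ᵥ w 0F) i; Bw0 = (B ·ᵥ w 0F) i; Aw1 = (A ·ᵥ w 1F) i; ABw0 = (A ·ᵥ (B ·ᵥ w 0F)) i
    expand : ((((-ₘ A) -ₘ B) +ₘ (+ 3 •ₘ (A ·ₘ B))) ·ᵥ w 0F) i ≡ - Aw0 - Bw0 + + 3 * ABw0
    expand = begin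
      ((((-ₘ A) -ₘ B) +ₘ (+ 3 •ₘ (A ·ₘ B))) ·ᵥ w 0F) i
        ≡⟨ ·ᵥ-distribʳ-+ₘ ((-ₘ A) -ₘ B) (+ 3 •ₘ (A ·ₘ B)) (w 0F) i ⟩
      (((-ₘ A) -ₘ B) ·ᵥ w 0F) i + ((+ 3 •ₘ (A ·ₘ B)) ·ᵥ w 0F) i
        ≡⟨ cong₂ _+_ (·ᵥ-distribʳ--ₘ (-ₘ A) B (w 0F) i) (·ᵥ-•ₘ (+ 3) (A ·ₘ B) (w 0F) i) ⟩
      (((-ₘ A) ·ᵥ w 0F) i - Bw0) + + 3 * ((A ·ₘ B) ·ᵥ w 0F) i
        ≡⟨ cong₂ (λ p q → (p - Bw0) + + 3 * q) (·ᵥ-negˡ A (w 0F) i) (·ᵥ-assoc A B (w 0F) i) ⟩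
      - Aw0 - Bw0 + + 3 * ABw0
        ∎
    tidy : ∀ p q r s → (- p - q + + 3 * r) + (- s + + 0) ≡ + 3 * r - p - q - s
    tidy = solve-∀
  matrixM-action w 1F i = begin
    ((-ₘ B) ·ᵥ w 0F) i + ((C ·ᵥ w 1F) i + + 0)
      ≡⟨ cong (_+ ((C ·ᵥ w 1F) i + + 0)) (·ᵥ-negˡ B (w 0F) i) ⟩
    - (B ·ᵥ w 0F) i + ((C ·ᵥ w 1F) i + + 0)
      ≡⟨ tidy ((B ·ᵥ w 0F) i) ((C ·ᵥ w 1F) i) ⟩
    (C ·ᵥ w 1F) i - (B ·ᵥ w 0F) i
      ∎
    where
    open ≡-Reasoning
    tidy : ∀ p q → - p + (q + + 0) ≡ q - p
    tidy = solve-∀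

theorem1 : (n : ℕ) → 1 ≤ n → (k l m : ℤ) → gcd4 k l m n ≡ 1 →
    TorIso (laplacianY n k l m) (matrixM n k l m)
theorem1 n _ k l m _ = CokernelEquivalence.torIso
  (YGraphReduction.cokernelEquivalence (cycBlock n k) (cycBlock n l) (cycBlock n m)
     (laplacianY n k l m) (matrixM n k l m) (laplacianY-action n k l m) (matrixM-action n k l m))
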